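{- Let $L$ be a linear order such that $L\times\mathbb Z=L\times(\omega^*+\omega)$ is indecomposable. Then $L$ is indecomposable.
   Context: $A\times B:=\sum_{a\in A}B$ (lexicographic product, first coordinate dominant); $\omega^*$ is $\omega$ reversed. A linear order $M$ is indecomposable if whenever $M$ embeds into $A+B$ for linear orders $A,B$, $M$ embeds into $A$ or into $B$. -}

module Defs where

open import Level using (0ℓ)
open import Data.Product using (Σ; _×_)
open import Data.Sum using (_⊎_)
open import Relation.Binary.Bundles using (StrictTotalOrder)
open import Data.Sum.Relation.Binary.LeftOrder using (⊎-<-strictTotalOrder)
open import Data.Product.Relation.Binary.Lex.Strict using (×-strictTotalOrder)
import Data.Integer.Properties as ℤP

LinOrder : Set₁
LinOrder = StrictTotalOrder 0ℓ 0ℓ 0ℓ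

record _↪_ (M N : LinOrder) : Set where
  private
    module M = StrictTotalOrder M
    module N = StrictTotalOrder N
  field
    fun  : M.Carrier → N.Carrier
    cong : ∀ {x y} → x M.≈ y → fun x N.≈ fun y
    mono : ∀ {x y} → x M.< y → fun x N.< fun y

_⊕_ : LinOrder → LinOrder → LinOrder
A ⊕ B = ⊎-<-strictTotalOrder {d = 0ℓ} {e = 0ℓ} {f = 0ℓ} A B

-- Lexicographic product A × B = Σ_{a ∈ A} B (first coordinate dominant).
_⊗_ : LinOrder → LinOrder → LinOrder
A ⊗ B = ×-strictTotalOrder A B

ℤ-order : LinOrder
ℤ-order = ℤP.<-strictTotalOrder

Indecomposable : LinOrder → Set₁
Indecomposable M = (A B : LinOrder) → M ↪ (A ⊕ B) → (M ↪ A) ⊎ (M ↪ B)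

{-# OPTIONS --safe #-}
module Submission where

-- An embedding of L into A + B induces one of L × ℤ into (A × ℤ) + (B × ℤ), so by
-- hypothesis L × ℤ embeds into A × ℤ or B × ℤ. It remains to cancel ℤ: given
-- g : L × ℤ ↪ X × ℤ, send l to the first coordinate of g (l , 0). Were l < l' sent to
-- the same x, then g (l , n) for n = 0, 1, 2, … would be trapped between g (l , 0)
-- and g (l' , 0) inside the single copy {x} × ℤ, giving a strictly increasing
-- sequence of integers bounded above.

open import Defs
open import Data.Product using (_,_; proj₁; proj₂)
open import Data.Sum using (inj₁; inj₂)
open import Data.Empty using (⊥-elim)
open import Data.Nat using (ℕ; zero; suc; s≤s; z≤n)
open import Data.Nat.Properties using (n<1+n)
open import Data.Integer as ℤ using (ℤ; +_; -[1+_]; 0ℤ; ∣_∣; _-_; _+_; _≤_; _<_; -≤+; +<+)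
import Data.Integer.Properties as ℤP
open import Algebra.Properties.AbelianGroup ℤP.+-0-abelianGroup using (//-rightDividesˡ)
open import Relation.Nullary using (¬_)
open import Relation.Binary.Bundles using (StrictTotalOrder)
import Relation.Binary.Properties.StrictTotalOrder as NonStrict
open import Relation.Binary.PropositionalEquality using (refl)
import Data.Sum.Relation.Binary.Pointwise as Pointwise
open import Data.Sum.Relation.Binary.LeftOrder using (₁∼₂; ₁∼₁; ₂∼₂)

private
  variable
    L M N X : LinOrder

↪-trans : L ↪ M → M ↪ N → L ↪ N
↪-trans f g = record
  { fun  = λ x → G.fun (F.fun x)
  ; cong = λ x≈y → G.cong (F.cong x≈y)
  ; mono = λ x<y → G.mono (F.mono x<y)
  }
  where
  module F = _↪_ f
  module G = _↪_ g

⊗-monoˡ-↪ : ∀ C → L ↪ M → (L ⊗ C) ↪ (M ⊗ C)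
⊗-monoˡ-↪ C f = record
  { fun  = λ { (l , c) → fun l , c }
  ; cong = λ { (l≈l' , c≈c') → cong l≈l' , c≈c' }
  ; mono = λ { (inj₁ l<l') → inj₁ (mono l<l')
             ; (inj₂ (l≈l' , c<c')) → inj₂ (cong l≈l' , c<c') }
  }
  where open _↪_ f

⊕-⊗-distribʳ-↪ : ∀ A B C → ((A ⊕ B) ⊗ C) ↪ ((A ⊗ C) ⊕ (B ⊗ C))
⊕-⊗-distribʳ-↪ A B C = record
  { fun  = λ { (inj₁ a , c) → inj₁ (a , c) ; (inj₂ b , c) → inj₂ (b , c) }
  ; cong = λ { (Pointwise.inj₁ a≈a' , c≈c') → Pointwise.inj₁ (a≈a' , c≈c')
             ; (Pointwise.inj₂ b≈b' , c≈c') → Pointwise.inj₂ (b≈b' , c≈c') }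
  ; mono = λ { (inj₁ ₁∼₂) → ₁∼₂
             ; (inj₁ (₁∼₁ a<a')) → ₁∼₁ (inj₁ a<a')
             ; (inj₁ (₂∼₂ b<b')) → ₂∼₂ (inj₁ b<b')
             ; (inj₂ (Pointwise.inj₁ a≈a' , c<c')) → ₁∼₁ (inj₂ (a≈a' , c<c'))
             ; (inj₂ (Pointwise.inj₂ b≈b' , c<c')) → ₂∼₂ (inj₂ (b≈b' , c<c')) }
  }

i≤+∣i∣ : ∀ i → i ≤ + ∣ i ∣
i≤+∣i∣ (+ n)    = ℤP.≤-refl
i≤+∣i∣ -[1+ n ] = -≤+

strictlyIncreasing⇒unbounded : (s : ℕ → ℤ) → (∀ n → s n < s (suc n)) →
                               ∀ b → ¬ (∀ n → s n < b)
strictlyIncreasing⇒unbounded s s-incr b s<b = ℤP.≤⇒≯ b≤sₙ (s<b n)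
  where
  open ℤP.≤-Reasoning
  n : ℕ
  n = ∣ b - s 0 ∣
  growth : ∀ k → + k + s 0 ≤ s k
  growth zero    = ℤP.≤-reflexive (ℤP.+-identityˡ (s 0))
  growth (suc k) = begin
    + suc k + s 0     ≡⟨ ℤP.suc-+ k (s 0) ⟩
    ℤ.suc (+ k + s 0) ≤⟨ ℤP.suc-mono (growth k) ⟩
    ℤ.suc (s k)       ≤⟨ ℤP.i<j⇒suc[i]≤j (s-incr k) ⟩
    s (suc k)         ∎
  b≤sₙ : b ≤ s n
  b≤sₙ = begin
    b               ≡⟨ //-rightDividesˡ (s 0) b ⟨
    (b - s 0) + s 0 ≤⟨ ℤP.+-monoˡ-≤ (s 0) (i≤+∣i∣ (b - s 0)) ⟩
    + n + s 0       ≤⟨ growth n ⟩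
    s n             ∎

module Lex (X Y : LinOrder) where
  private
    module X = StrictTotalOrder X
    module Y = StrictTotalOrder Y
    module X⊗Y = StrictTotalOrder (X ⊗ Y)
    module X≤ = NonStrict X

  <ₗₑₓ⇒proj₁≤ : ∀ {p q} → p X⊗Y.< q → proj₁ p X≤.≤ proj₁ q
  <ₗₑₓ⇒proj₁≤ (inj₁ p₁<q₁)       = inj₁ p₁<q₁
  <ₗₑₓ⇒proj₁≤ (inj₂ (p₁≈q₁ , _)) = inj₂ p₁≈q₁

  <ₗₑₓ∧proj₁≈⇒proj₂< : ∀ {p q} → p X⊗Y.< q → proj₁ p X.≈ proj₁ q → proj₂ p Y.< proj₂ q
  <ₗₑₓ∧proj₁≈⇒proj₂< (inj₁ p₁<q₁)        p₁≈q₁ = ⊥-elim (X.irrefl p₁≈q₁ p₁<q₁)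
  <ₗₑₓ∧proj₁≈⇒proj₂< (inj₂ (_ , p₂<q₂)) _     = p₂<q₂

⊗ℤ-cancelʳ-↪ : (L ⊗ ℤ-order) ↪ (X ⊗ ℤ-order) → L ↪ X
⊗ℤ-cancelʳ-↪ {L} {X} g = record
  { fun  = f
  ; cong = λ l≈l' → proj₁ (G.cong (l≈l' , refl))
  ; mono = f-mono
  }
  where
  module L = StrictTotalOrder L
  module X = StrictTotalOrder X
  module X⊗ℤ = StrictTotalOrder (X ⊗ ℤ-order)
  module X≤ = NonStrict X
  module G = _↪_ g
  open Lex X ℤ-order

  f : L.Carrier → X.Carrier
  f l = proj₁ (G.fun (l , 0ℤ))

  f-injective-on-< : ∀ {l l'} → l L.< l' → ¬ (f l X.≈ f l')
  f-injective-on-< {l} {l'} l<l' fl≈fl' = strictlyIncreasing⇒unbounded s s-incr b sₙ<b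
    where
    s : ℕ → ℤ
    s n = proj₂ (G.fun (l , + n))
    b : ℤ
    b = proj₂ (G.fun (l' , 0ℤ))

    G-below : ∀ z → G.fun (l , z) X⊗ℤ.< G.fun (l' , 0ℤ)
    G-below z = G.mono (inj₁ l<l')

    fl≤ : ∀ n → f l X≤.≤ proj₁ (G.fun (l , + n))
    fl≤ zero    = X≤.refl
    fl≤ (suc n) = <ₗₑₓ⇒proj₁≤ (G.mono (inj₂ (L.Eq.refl , +<+ (s≤s z≤n))))

    same-row : ∀ n → proj₁ (G.fun (l , + n)) X.≈ f l'
    same-row n = X≤.antisym (<ₗₑₓ⇒proj₁≤ (G-below (+ n)))
                            (X≤.trans (X≤.reflexive (X.Eq.sym fl≈fl')) (fl≤ n))

    s-incr : ∀ n → s n < s (suc n)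
    s-incr n = <ₗₑₓ∧proj₁≈⇒proj₂< (G.mono (inj₂ (L.Eq.refl , +<+ (n<1+n n))))
                                   (X.Eq.trans (same-row n) (X.Eq.sym (same-row (suc n))))

    sₙ<b : ∀ n → s n < b
    sₙ<b n = <ₗₑₓ∧proj₁≈⇒proj₂< (G-below (+ n)) (same-row n)

  f-mono : ∀ {l l'} → l L.< l' → f l X.< f l'
  f-mono l<l' with <ₗₑₓ⇒proj₁≤ (G.mono (inj₁ l<l'))
  ... | inj₁ fl<fl' = fl<fl'
  ... | inj₂ fl≈fl' = ⊥-elim (f-injective-on-< l<l' fl≈fl')

lemma4p6 : (L : LinOrder) → Indecomposable (L ⊗ ℤ-order) → Indecomposable L
lemma4p6 L ind A B e with ind (A ⊗ ℤ-order) (B ⊗ ℤ-order)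
                              (↪-trans (⊗-monoˡ-↪ ℤ-order e) (⊕-⊗-distribʳ-↪ A B ℤ-order))
... | inj₁ g = inj₁ (⊗ℤ-cancelʳ-↪ g)
... | inj₂ g = inj₂ (⊗ℤ-cancelʳ-↪ g)
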